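{- Let $B=B'(p)$, let $\beta_1:=\min\{\max_{s\in S}z(s):z\in B\cap\mathbb{Z}^S\}$, and let $r_1$ be the minimum number of components equal to $\beta_1$ over all $\beta_1$-covered elements of $B\cap\mathbb{Z}^S$. Define $h_1(X):=p(X)-(\beta_1-1)|X|$ for $X\subseteq S$. Then $$r_1=\max\{h_1(X):X\subseteq S\}.$$
   Context: $S$ is a finite non-empty set; $p$ is a set-function on subsets of $S$ with values in $\mathbb{Z}\cup\{ -\infty\}$, $p(\emptyset)=0$, $p(S)$ finite, and supermodular: $p(X)+p(Y)\le p(X\cap Y)+p(X\cup Y)$ whenever $p(X),p(Y)$ are finite. $B'(p)=\{x\in\mathbb{R}^S:\widetilde x(S)=p(S),\ \widetilde x(Z)\ge p(Z)\ \forall Z\subset S\}$ with $\widetilde x(Z)=\sum_{s\in Z}x(s)$. A vector is $\beta$-covered if each of its components is at most $\beta$. -}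

module Defs where

open import Data.Nat as ℕ using (ℕ; zero; suc)
open import Data.Integer using (ℤ; _+_; _-_; _*_; _≤_; +_; 0ℤ; 1ℤ)
open import Data.Integer.Properties using (_≟_)
open import Data.Fin using (Fin)
open import Data.Fin.Subset using (Subset; ⊤; ⊥; _∩_; _∪_; _⊂_; ∣_∣)
open import Data.Vec using (lookup)
open import Data.Bool using (Bool; true; false; if_then_else_)
open import Data.Product using (Σ; ∃; _×_)
open import Relation.Binary.PropositionalEquality using (_≡_)
open import Relation.Nullary.Decidable using (⌊_⌋)
import Data.Unit as U
import Data.Empty as E

data ℤ∞ : Set where
  -∞  : ℤ∞
  fin : ℤ → ℤ∞

_≤∞_ : ℤ∞ → ℤ → Set
-∞    ≤∞ b = U.⊤
fin a ≤∞ b = a ≤ b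

_⊖∞_ : ℤ∞ → ℤ → ℤ∞
-∞    ⊖∞ c = -∞
fin a ⊖∞ c = fin (a - c)

sumFin : (n : ℕ) → (Fin n → ℤ) → ℤ
sumFin zero    f = 0ℤ
sumFin (suc n) f = f Fin.zero + sumFin n (λ i → f (Fin.suc i))
  where import Data.Fin as Fin

countFin : (n : ℕ) → (Fin n → Bool) → ℕ
countFin zero    f = zero
countFin (suc n) f = (if f Fin.zero then 1 else 0) ℕ.+ countFin n (λ i → f (Fin.suc i))
  where import Data.Fin as Fin

SetFn : ℕ → Set
SetFn n = Subset n → ℤ∞

x̃ : {n : ℕ} → (Fin n → ℤ) → Subset n → ℤ
x̃ {n} x Z = sumFin n (λ i → if lookup Z i then x i else 0ℤ)

Supermodular : {n : ℕ} → SetFn n → Set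
Supermodular {n} p = (X Y : Subset n) (a b : ℤ) → p X ≡ fin a → p Y ≡ fin b →
  Σ ℤ λ c → Σ ℤ λ d → p (X ∩ Y) ≡ fin c × p (X ∪ Y) ≡ fin d × (a + b ≤ c + d)

InB' : {n : ℕ} → SetFn n → (Fin n → ℤ) → Set
InB' {n} p x = (p ⊤ ≡ fin (x̃ x ⊤)) × ((Z : Subset n) → Z ⊂ ⊤ → p Z ≤∞ x̃ x Z)

IsMaxComp : {n : ℕ} → (Fin n → ℤ) → ℤ → Set
IsMaxComp {n} z β = ((s : Fin n) → z s ≤ β) × (∃ λ s → z s ≡ β)

Covered : {n : ℕ} → ℤ → (Fin n → ℤ) → Set
Covered {n} β z = (s : Fin n) → z s ≤ β

numEq : {n : ℕ} → (Fin n → ℤ) → ℤ → ℕ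
numEq {n} z β = countFin n (λ s → ⌊ z s ≟ β ⌋)

IsBeta1 : {n : ℕ} → SetFn n → ℤ → Set
IsBeta1 {n} p β =
  (Σ (Fin n → ℤ) λ z → InB' p z × IsMaxComp z β) ×
  ((z : Fin n → ℤ) (m : ℤ) → InB' p z → IsMaxComp z m → β ≤ m)

IsR1 : {n : ℕ} → SetFn n → ℤ → ℕ → Set
IsR1 {n} p β r =
  (Σ (Fin n → ℤ) λ z → InB' p z × Covered β z × numEq z β ≡ r) ×
  ((z : Fin n → ℤ) → InB' p z → Covered β z → r ℕ.≤ numEq z β)

h : {n : ℕ} → SetFn n → ℤ → Subset n → ℤ∞
h p β X = p X ⊖∞ ((β - 1ℤ) * + ∣ X ∣)

IsMaxSet : {n : ℕ} → (Subset n → ℤ∞) → ℤ → Set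
IsMaxSet {n} f m = ((X : Subset n) → f X ≤∞ m) × (∃ λ X → f X ≡ fin m)

-- Call x feasible if x̃(Z) ≥ p(Z) for all Z, and Z tight for x if equality holds;
-- by supermodularity the tight sets of a feasible x are closed under union.
-- Let β be least such that the constant vector β is feasible. Lowering, one at a
-- time, entries equal to β that lie in no tight set preserves feasibility and ends
-- at a feasible x with entries in {β − 1, β} whose β-entries all lie in a single
-- tight set T, so that h₁(T) = #{s : x(s) = β}. Lowering free entries further
-- reaches some y ≤ x in B'(p); β₁ = β because an element of B'(p) below β − 1
-- would make the constant β − 1 feasible. For every feasible β-covered z and
-- every X,  p(X) ≤ x̃(X) ≤ (β − 1)|X| + #{s : z(s) = β},  i.e. h₁(X) is at most
-- the number of β-entries of z. Taking X = T and z = y shows that y has as many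
-- β-entries as x, and that this number is both r₁ and max h₁.
module Submission where

open import Defs
open import Data.Nat using (ℕ; _<_)
open import Data.Integer using (ℤ; 0ℤ; +_)
open import Data.Fin.Subset using (⊤; ⊥)
open import Data.Product using (Σ; ∃; _×_)
open import Relation.Binary.PropositionalEquality using (_≡_)

open import Level using (0ℓ)
open import Data.Bool using (Bool; true; false; T; if_then_else_; _∧_; _∨_)
open import Data.Bool.Properties using (T-∧; T-≡)
import Data.Nat as ℕ
import Data.Nat.Properties as ℕ
open import Data.Integer
  using (1ℤ; -1ℤ; _+_; _-_; -_; _*_; -[1+_]; _≤_; _≤?_; +≤+; -≤+; -<+; -<-)
  renaming (∣_∣ to ∣_∣ℤ)
open import Data.Integer.Properties
  using ( _≟_; ≤-refl; ≤-reflexive; ≤-trans; ≤-antisym; ≤-<-trans; <-irrefl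
        ; ≤∧≢⇒<; ≰⇒>; i<j⇒i≤pred[j]; +-comm; +-assoc; +-identityˡ; +-identityʳ; i-j≤i; +-mono-≤
        ; +-monoʳ-≤; +-monoˡ-≤; +-mono-≤-<; *-zeroʳ; *-suc; *-monoʳ-≤-nonNeg; pos-+
        ; pos-*; ∣-∣-≤; drop‿+≤+; module ≤-Reasoning)
open import Data.Integer.Tactic.RingSolver using (solve-∀)
open import Data.Fin using (Fin; zero; suc) renaming (_≟_ to _≟ᶠ_)
open import Data.Fin.Subset using (Subset; _∈_; _∉_; _∩_; _∪_; ∣_∣; inside; outside)
open import Data.Fin.Subset.Properties
  using ( _∈?_; ∈⊤; ⊆⊤; ⊆-antisym; p⊆p∪q; q⊆p∪q; nonempty?; Empty-unique
        ; x∈p⇒∣p-x∣<∣p∣; ∣⊤∣≡n; anySubset?)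
open import Data.Fin.Properties using (any?; all?; ¬∀⟶∃¬)
open import Data.Vec using ([]; _∷_; lookup; here; there)
open import Data.Vec.Properties using ([]=⇒lookup)
open import Data.Vec.Functional using (Vector; updateAt)
open import Data.Vec.Functional.Properties using (updateAt-updates; updateAt-minimal)
open import Data.List using ([]; _∷_; filter; allFin)
open import Data.List.Relation.Unary.All as All using (All; []; _∷_)
open import Data.List.Relation.Unary.All.Properties using (all-filter)
open import Data.List.Membership.Propositional.Properties using (∈-filter⁺; ∈-allFin)
open import Data.Sum using (_⊎_; inj₁; inj₂; [_,_])
open import Data.Product using (_,_; proj₂)
open import Data.Empty using (⊥-elim)
open import Data.Unit using (tt)
import Data.Unit as Unit
open import Function using (_∘_; Equivalence)
open import Relation.Unary using (Pred; Decidable)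
open import Relation.Nullary
  using (¬_; Dec; yes; no; ¬?; _×-dec_; contradiction; decidable-stable)
open import Relation.Nullary.Decidable using (⌊_⌋; toWitness; fromWitness; map′)
open import Relation.Binary.PropositionalEquality
  using (refl; sym; trans; cong; cong₂; subst; _≢_; module ≡-Reasoning)

private
  variable
    n : ℕ

≤∧≢⇒≤-1 : ∀ {i j} → i ≤ j → i ≢ j → i ≤ j - 1ℤ
≤∧≢⇒≤-1 {i} {j} i≤j i≢j = subst (i ≤_) (+-comm -1ℤ j) (i<j⇒i≤pred[j] (≤∧≢⇒< i≤j i≢j))

≰⇒≤-1 : ∀ {i j} → ¬ j ≤ i → i ≤ j - 1ℤ
≰⇒≤-1 {i} {j} j≰i = subst (i ≤_) (+-comm -1ℤ j) (i<j⇒i≤pred[j] (≰⇒> j≰i))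

[i+1+k]-1≡i+k : ∀ i k → (i + + ℕ.suc k) - 1ℤ ≡ i + + k
[i+1+k]-1≡i+k i k = lemma i (+ k)
  where
  lemma : ∀ i j → (i + (1ℤ + j)) - 1ℤ ≡ i + j
  lemma = solve-∀

i-1+1≡i : ∀ i → (i - 1ℤ) + 1ℤ ≡ i
i-1+1≡i = solve-∀

≤⇒≡+∣-∣ : ∀ {i j} → i ≤ j → j ≡ i + + ∣ i - j ∣ℤ
≤⇒≡+∣-∣ {i} {j} i≤j = trans (sym (lemma i j)) (cong (λ k → i + k) (sym (∣-∣-≤ i≤j)))
  where
  lemma : ∀ i j → i + (j - i) ≡ j
  lemma = solve-∀

≤∞-trans : ∀ {v a b} → v ≤∞ a → a ≤ b → v ≤∞ b
≤∞-trans { -∞}   _   _   = tt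
≤∞-trans {fin _} v≤a a≤b = ≤-trans v≤a a≤b

≤∞-pred : ∀ {v a} → v ≤∞ a → v ≢ fin a → v ≤∞ (a - 1ℤ)
≤∞-pred { -∞}   _   _   = tt
≤∞-pred {fin _} v≤a v≢a = ≤∧≢⇒≤-1 v≤a (v≢a ∘ cong fin)

⊖∞-≤∞ : ∀ v w r → v ≤∞ (w + r) → (v ⊖∞ w) ≤∞ r
⊖∞-≤∞ -∞      _ _ _     = tt
⊖∞-≤∞ (fin a) w r a≤w+r = subst (a - w ≤_) (lemma w r) (+-monoˡ-≤ (- w) a≤w+r)
  where
  lemma : ∀ w r → (w + r) - w ≡ r
  lemma = solve-∀

_≤∞?_ : (v : ℤ∞) (a : ℤ) → Dec (v ≤∞ a)
-∞    ≤∞? _ = yes tt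
fin b ≤∞? a = b ≤? a

_≟fin_ : (v : ℤ∞) (a : ℤ) → Dec (v ≡ fin a)
-∞    ≟fin _ = no λ ()
fin b ≟fin a = map′ (cong fin) (λ { refl → refl }) (b ≟ a)

bounded : (f : Subset n → ℤ∞) → ∃ λ N → ∀ X → f X ≤∞ (+ N)
bounded {ℕ.zero} f = bound (f []) , λ { [] → bound-≥ (f []) }
  where
  bound : ℤ∞ → ℕ
  bound -∞      = 0
  bound (fin a) = ∣ a ∣ℤ
  bound-≥ : ∀ v → v ≤∞ (+ bound v)
  bound-≥ -∞            = tt
  bound-≥ (fin (+ _))    = ≤-refl
  bound-≥ (fin -[1+ _ ]) = -≤+
bounded {ℕ.suc n} f with bounded (f ∘ (inside ∷_)) | bounded (f ∘ (outside ∷_))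
... | N₁ , f₁≤N₁ | N₂ , f₂≤N₂ = N₁ ℕ.⊔ N₂ , λ
  { (inside ∷ X)  → ≤∞-trans {f (inside ∷ X)} (f₁≤N₁ X) (+≤+ (ℕ.m≤m⊔n N₁ N₂))
  ; (outside ∷ X) → ≤∞-trans {f (outside ∷ X)} (f₂≤N₂ X) (+≤+ (ℕ.m≤n⊔m N₁ N₂)) }

x̃-mono : ∀ {x y : Vector ℤ n} → (∀ s → x s ≤ y s) → ∀ Z → x̃ x Z ≤ x̃ y Z
x̃-mono {ℕ.zero}  _   []            = ≤-refl
x̃-mono {ℕ.suc _} x≤y (inside ∷ Z)  = +-mono-≤ (x≤y zero) (x̃-mono (x≤y ∘ suc) Z)
x̃-mono {ℕ.suc _} x≤y (outside ∷ Z) = +-monoʳ-≤ 0ℤ (x̃-mono (x≤y ∘ suc) Z)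

x̃-cong : ∀ {x y : Vector ℤ n} → (∀ s → x s ≡ y s) → ∀ Z → x̃ x Z ≡ x̃ y Z
x̃-cong x≡y Z = ≤-antisym (x̃-mono (≤-reflexive ∘ x≡y) Z) (x̃-mono (≤-reflexive ∘ sym ∘ x≡y) Z)

x̃-+ : ∀ (x y : Vector ℤ n) Z → x̃ (λ s → x s + y s) Z ≡ x̃ x Z + x̃ y Z
x̃-+ {ℕ.zero}  _ _ []      = refl
x̃-+ {ℕ.suc _} x y (b ∷ Z) =
  trans (cong₂ _+_ (head b) (x̃-+ (x ∘ suc) (y ∘ suc) Z))
        (interchange (if b then x zero else 0ℤ) (if b then y zero else 0ℤ)
                     (x̃ (x ∘ suc) Z) (x̃ (y ∘ suc) Z))
  where
  head : ∀ b → (if b then x zero + y zero else 0ℤ)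
             ≡ (if b then x zero else 0ℤ) + (if b then y zero else 0ℤ)
  head true  = refl
  head false = refl
  interchange : ∀ a b c d → (a + b) + (c + d) ≡ (a + c) + (b + d)
  interchange = solve-∀

x̃-const : ∀ w (Z : Subset n) → x̃ (λ _ → w) Z ≡ w * + ∣ Z ∣
x̃-const w []            = sym (*-zeroʳ w)
x̃-const w (inside ∷ Z)  = trans (cong (_+_ w) (x̃-const w Z)) (sym (*-suc w (+ ∣ Z ∣)))
x̃-const w (outside ∷ Z) = trans (+-identityˡ _) (x̃-const w Z)

x̃-count : ∀ (f : Fin n → Bool) Z →
  x̃ (λ s → + (if f s then 1 else 0)) Z ≡ + countFin n (λ s → lookup Z s ∧ f s)
x̃-count _ []            = refl
x̃-count f (inside ∷ Z)  =
  trans (cong (_+_ (+ _)) (x̃-count (f ∘ suc) Z)) (sym (pos-+ (if f zero then 1 else 0) _))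
x̃-count f (outside ∷ Z) = trans (+-identityˡ _) (x̃-count (f ∘ suc) Z)

x̃-modular : ∀ (x : Vector ℤ n) X Y → x̃ x X + x̃ x Y ≡ x̃ x (X ∩ Y) + x̃ x (X ∪ Y)
x̃-modular _ [] [] = refl
x̃-modular x (b ∷ X) (c ∷ Y) =
  trans (interchange (ite b) (x̃ (x ∘ suc) X) (ite c) (x̃ (x ∘ suc) Y))
    (trans (cong₂ _+_ (head b c) (x̃-modular (x ∘ suc) X Y))
      (interchange (ite (b ∧ c)) (ite (b ∨ c)) (x̃ (x ∘ suc) (X ∩ Y)) (x̃ (x ∘ suc) (X ∪ Y))))
  where
  ite : Bool → ℤ
  ite b = if b then x zero else 0ℤ
  head : ∀ b c → ite b + ite c ≡ ite (b ∧ c) + ite (b ∨ c)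
  head true  true  = refl
  head true  false = +-comm (x zero) 0ℤ
  head false true  = refl
  head false false = refl
  interchange : ∀ a b c d → (a + b) + (c + d) ≡ (a + c) + (b + d)
  interchange = solve-∀

x̃-⊥ : ∀ (x : Vector ℤ n) → x̃ x ⊥ ≡ 0ℤ
x̃-⊥ {ℕ.zero}  _ = refl
x̃-⊥ {ℕ.suc _} x = trans (+-identityˡ _) (x̃-⊥ (x ∘ suc))

decrementAt : Vector ℤ n → Fin n → Vector ℤ n
decrementAt x s = updateAt x s (_- 1ℤ)

decrementAt-≤ : ∀ (x : Vector ℤ n) s t → decrementAt x s t ≤ x t
decrementAt-≤ x s t with t ≟ᶠ s
... | yes refl = subst (_≤ x t) (sym (updateAt-updates t x)) (i-j≤i (x t) 1ℤ)
... | no t≢s   = ≤-reflexive (updateAt-minimal t s x t≢s)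

x̃-decrementAt-∈ : ∀ (x : Vector ℤ n) {s Z} → s ∈ Z → x̃ (decrementAt x s) Z ≡ x̃ x Z - 1ℤ
x̃-decrementAt-∈ x {Z = inside ∷ Z} here = lemma (x zero) (x̃ (x ∘ suc) Z)
  where
  lemma : ∀ a r → (a - 1ℤ) + r ≡ (a + r) - 1ℤ
  lemma = solve-∀
x̃-decrementAt-∈ x {Z = b ∷ Z} (there s∈Z) =
  trans (cong (_+_ (if b then x zero else 0ℤ)) (x̃-decrementAt-∈ (x ∘ suc) s∈Z))
        (sym (+-assoc (if b then x zero else 0ℤ) (x̃ (x ∘ suc) Z) -1ℤ))

x̃-decrementAt-∉ : ∀ (x : Vector ℤ n) {s Z} → s ∉ Z → x̃ (decrementAt x s) Z ≡ x̃ x Z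
x̃-decrementAt-∉ x {zero}  {inside ∷ Z}  s∉Z = contradiction here s∉Z
x̃-decrementAt-∉ x {zero}  {outside ∷ Z} _   = refl
x̃-decrementAt-∉ x {suc s} {b ∷ Z}       s∉Z =
  cong (_+_ (if b then x zero else 0ℤ)) (x̃-decrementAt-∉ (x ∘ suc) (s∉Z ∘ there))

countFin-mono : ∀ {f g : Fin n → Bool} → (∀ s → T (f s) → T (g s)) → countFin n f ℕ.≤ countFin n g
countFin-mono {ℕ.zero}          _   = ℕ.z≤n
countFin-mono {ℕ.suc _} {f} {g} f⇒g =
  ℕ.+-mono-≤ (head (f zero) (g zero) (f⇒g zero)) (countFin-mono (f⇒g ∘ suc))
  where
  head : ∀ a b → (T a → T b) → (if a then 1 else 0) ℕ.≤ (if b then 1 else 0)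
  head false _     _   = ℕ.z≤n
  head true  true  _   = ℕ.≤-refl
  head true  false a⇒b = ⊥-elim (a⇒b tt)

numEqIn : Subset n → Vector ℤ n → ℤ → ℕ
numEqIn {n} X z β = countFin n (λ s → lookup X s ∧ ⌊ z s ≟ β ⌋)

numEqIn≤numEq : ∀ X (z : Vector ℤ n) β → numEqIn X z β ℕ.≤ numEq z β
numEqIn≤numEq X z β = countFin-mono λ s → proj₂ ∘ Equivalence.to (T-∧ {lookup X s})

numEq≤numEqIn : ∀ X (z : Vector ℤ n) β → (∀ s → z s ≡ β → s ∈ X) → numEq z β ℕ.≤ numEqIn X z β
numEq≤numEqIn X z β β∈X = countFin-mono λ s zs≡β →
  Equivalence.from (T-∧ {lookup X s})
    (Equivalence.from T-≡ ([]=⇒lookup (β∈X s (toWitness zs≡β))) , zs≡β)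

numEq-mono : ∀ {y x : Vector ℤ n} {β} → (∀ s → y s ≤ x s) → Covered β x → numEq y β ℕ.≤ numEq x β
numEq-mono {y = y} {x} y≤x x≤β = countFin-mono λ s ys≡β →
  fromWitness (≤-antisym (x≤β s) (subst (_≤ x s) (toWitness ys≡β) (y≤x s)))

twoLevelCap : ℤ → Vector ℤ n → Vector ℤ n
twoLevelCap β z s = (β - 1ℤ) + + (if ⌊ z s ≟ β ⌋ then 1 else 0)

x̃-twoLevelCap : ∀ β (z : Vector ℤ n) X →
  x̃ (twoLevelCap β z) X ≡ (β - 1ℤ) * + ∣ X ∣ + + numEqIn X z β
x̃-twoLevelCap β z X =
  trans (x̃-+ (λ _ → β - 1ℤ) _ X) (cong₂ _+_ (x̃-const (β - 1ℤ) X) (x̃-count _ X))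

≤-twoLevelCap : ∀ {β} {z : Vector ℤ n} s → z s ≤ β → z s ≤ twoLevelCap β z s
≤-twoLevelCap {β = β} {z} s zs≤β with z s ≟ β
... | yes zs≡β = ≤-reflexive (trans zs≡β (sym (i-1+1≡i β)))
... | no  zs≢β = subst (z s ≤_) (sym (+-identityʳ (β - 1ℤ))) (≤∧≢⇒≤-1 zs≤β zs≢β)

≡-twoLevelCap : ∀ {β} {z : Vector ℤ n} s → z s ≡ β ⊎ z s ≡ β - 1ℤ → z s ≡ twoLevelCap β z s
≡-twoLevelCap {β = β} {z} s zs-two with z s ≟ β | zs-two
... | yes zs≡β | _          = trans zs≡β (sym (i-1+1≡i β))
... | no  zs≢β | inj₁ zs≡β  = contradiction zs≡β zs≢β
... | no  _    | inj₂ zs≡β-1 = trans zs≡β-1 (sym (+-identityʳ (β - 1ℤ)))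

Feasible : SetFn n → Vector ℤ n → Set
Feasible {n} p x = (Z : Subset n) → p Z ≤∞ x̃ x Z

Tight : SetFn n → Vector ℤ n → Subset n → Set
Tight p x Z = p Z ≡ fin (x̃ x Z)

TightAt : SetFn n → Vector ℤ n → Fin n → Set
TightAt {n} p x s = ∃ λ (Z : Subset n) → s ∈ Z × Tight p x Z

TwoLevel : ℤ → Vector ℤ n → Set
TwoLevel {n} β x = (s : Fin n) → x s ≡ β ⊎ x s ≡ β - 1ℤ

feasible? : ∀ (p : SetFn n) x → Dec (Feasible p x)
feasible? p x with anySubset? (λ Z → ¬? (p Z ≤∞? x̃ x Z))
... | yes (Z , violated) = no λ x-feas → violated (x-feas Z)
... | no  none           =
  yes λ Z → decidable-stable (p Z ≤∞? x̃ x Z) (λ violated → none (Z , violated))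

feasible-mono : ∀ {p : SetFn n} {x y} → Feasible p x → (∀ s → x s ≤ y s) → Feasible p y
feasible-mono {p = p} x-feas x≤y Z = ≤∞-trans {p Z} (x-feas Z) (x̃-mono x≤y Z)

InB'⇒Feasible : ∀ {p : SetFn n} {x} → InB' p x → Feasible p x
InB'⇒Feasible {n} {p} {x} (p⊤≡x⊤ , x≥p) Z with all? (_∈? Z)
... | yes all∈Z = subst (λ Y → p Y ≤∞ x̃ x Y) (sym (⊆-antisym ⊆⊤ (λ {s} _ → all∈Z s)))
                    (subst (_≤∞ x̃ x ⊤) (sym p⊤≡x⊤) ≤-refl)
... | no  ¬all  with ¬∀⟶∃¬ n (_∈ Z) (_∈? Z) ¬all
...   | s , s∉Z = x≥p Z (⊆⊤ , s , ∈⊤ , s∉Z)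

Feasible∧Tight⇒InB' : ∀ {p : SetFn n} {x} → Feasible p x → Tight p x ⊤ → InB' p x
Feasible∧Tight⇒InB' x-feas ⊤-tight = ⊤-tight , λ Z _ → x-feas Z

tightAt? : ∀ (p : SetFn n) x → Decidable (TightAt p x)
tightAt? p x s = anySubset? λ Z → s ∈? Z ×-dec p Z ≟fin x̃ x Z

decrementAt-feasible : ∀ {p : SetFn n} {x s} → Feasible p x → ¬ TightAt p x s →
  Feasible p (decrementAt x s)
decrementAt-feasible {p = p} {x} {s} x-feas loose Z with s ∈? Z
... | yes s∈Z = subst (p Z ≤∞_) (sym (x̃-decrementAt-∈ x s∈Z))
                  (≤∞-pred (x-feas Z) (λ Z-tight → loose (Z , s∈Z , Z-tight)))
... | no  s∉Z = subst (p Z ≤∞_) (sym (x̃-decrementAt-∉ x s∉Z)) (x-feas Z)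

module _ {p : SetFn n} (supermodular : Supermodular p) (p⊥ : p ⊥ ≡ fin 0ℤ)
         {x : Vector ℤ n} (x-feas : Feasible p x) where

  tight-⊥ : Tight p x ⊥
  tight-⊥ = trans p⊥ (cong fin (sym (x̃-⊥ x)))

  tight-∪ : ∀ {X Y} → Tight p x X → Tight p x Y → Tight p x (X ∪ Y)
  tight-∪ {X} {Y} X-tight Y-tight with supermodular X Y _ _ X-tight Y-tight
  ... | c , d , p∩≡c , p∪≡d , sum≤ =
    trans p∪≡d (cong fin (squeeze (subst (_≤∞ x̃ x (X ∩ Y)) p∩≡c (x-feas (X ∩ Y)))
                                  (subst (_≤∞ x̃ x (X ∪ Y)) p∪≡d (x-feas (X ∪ Y)))
                                  (subst (_≤ c + d) (x̃-modular x X Y) sum≤)))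
    where
    squeeze : ∀ {c d a b} → c ≤ a → d ≤ b → a + b ≤ c + d → d ≡ b
    squeeze {c} {d} {a} {b} c≤a d≤b a+b≤c+d with d ≟ b
    ... | yes d≡b = d≡b
    ... | no  d≢b =
      contradiction (≤-<-trans a+b≤c+d (+-mono-≤-< c≤a (≤∧≢⇒< d≤b d≢b))) (<-irrefl refl)

  tight-⋃ : ∀ ss → All (TightAt p x) ss → ∃ λ U → Tight p x U × All (_∈ U) ss
  tight-⋃ []       []                            = ⊥ , tight-⊥ , []
  tight-⋃ (s ∷ ss) ((Z , s∈Z , Z-tight) ∷ tights) with tight-⋃ ss tights
  ... | U , U-tight , ss⊆U =
    Z ∪ U , tight-∪ Z-tight U-tight , p⊆p∪q U s∈Z ∷ All.map (q⊆p∪q Z U) ss⊆U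

  tight-cover : ∀ {P : Pred (Fin n) 0ℓ} → Decidable P → (∀ s → P s → TightAt p x s) →
                ∃ λ U → Tight p x U × (∀ s → P s → s ∈ U)
  tight-cover P? P⇒tight
    with tight-⋃ (filter P? (allFin _)) (All.map (P⇒tight _) (all-filter P? (allFin _)))
  ... | U , U-tight , P⊆U = U , U-tight , λ s Ps → All.lookup P⊆U (∈-filter⁺ P? (∈-allFin s) Ps)

-- Lower by one, while possible, an entry satisfying D that lies in no tight set.
module Descent {p : SetFn n} {c : ℤ} (p⊤ : p ⊤ ≡ fin c)
  (D : Vector ℤ n → Pred (Fin n) 0ℓ) (D? : ∀ x → Decidable (D x))
  (I : Vector ℤ n → Set) (I-step : ∀ {x s} → I x → D x s → I (decrementAt x s)) where

  Settled : Vector ℤ n → Set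
  Settled y = ∀ s → D y s → TightAt p y s

  descend-by : ∀ k x → x̃ x ⊤ ≡ c + + k → Feasible p x → I x →
               ∃ λ y → Feasible p y × I y × Settled y
  descend-by ℕ.zero x x⊤≡c x-feas x-inv =
    x , x-feas , x-inv , λ s _ → ⊤ , ∈⊤ , trans p⊤ (cong fin (sym (trans x⊤≡c (+-identityʳ c))))
  descend-by (ℕ.suc k) x x⊤≡c+k x-feas x-inv with any? (λ s → D? x s ×-dec ¬? (tightAt? p x s))
  ... | yes (s , Ds , loose) =
    descend-by k (decrementAt x s)
      (trans (x̃-decrementAt-∈ x ∈⊤) (trans (cong (_- 1ℤ) x⊤≡c+k) ([i+1+k]-1≡i+k c k)))
      (decrementAt-feasible x-feas loose) (I-step x-inv Ds)
  ... | no none = x , x-feas , x-inv , λ s Ds →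
    decidable-stable (tightAt? p x s) (λ loose → none (s , Ds , loose))

  descend : ∀ x → Feasible p x → I x → ∃ λ y → Feasible p y × I y × Settled y
  descend x x-feas = descend-by _ x (≤⇒≡+∣-∣ (subst (_≤∞ x̃ x ⊤) p⊤ (x-feas ⊤))) x-feas

lower-to-two-levels : ∀ {p : SetFn n} {c β} → p ⊤ ≡ fin c → Feasible p (λ _ → β) →
  ∃ λ x → Feasible p x × TwoLevel β x × (∀ s → x s ≡ β → TightAt p x s)
lower-to-two-levels {n} {p} {β = β} p⊤ β-feas =
  Descent.descend p⊤ (λ x s → x s ≡ β) (λ x s → x s ≟ β) (TwoLevel β) step
                  (λ _ → β) β-feas (λ _ → inj₁ refl)
  where
  step : ∀ {x : Vector ℤ n} {s} → TwoLevel β x → x s ≡ β → TwoLevel β (decrementAt x s)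
  step {x} {s} x-two xs≡β t with t ≟ᶠ s
  ... | yes refl = inj₂ (trans (updateAt-updates t x) (cong (_- 1ℤ) xs≡β))
  ... | no  t≢s  = subst (λ v → v ≡ β ⊎ v ≡ β - 1ℤ) (sym (updateAt-minimal t s x t≢s)) (x-two t)

B'-below : ∀ {p : SetFn n} {c x} → Supermodular p → p ⊥ ≡ fin 0ℤ → p ⊤ ≡ fin c → Feasible p x →
  ∃ λ y → InB' p y × (∀ s → y s ≤ x s)
B'-below {n} {p} {x = x} supermodular p⊥ p⊤ x-feas
  with Descent.descend p⊤ (λ _ _ → Unit.⊤) (λ _ _ → yes tt) (λ y → ∀ s → y s ≤ x s)
         (λ y≤x _ t → ≤-trans (decrementAt-≤ _ _ t) (y≤x t)) x x-feas (λ _ → ≤-refl)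
... | y , y-feas , y≤x , settled with tight-cover supermodular p⊥ y-feas (λ _ → yes tt) settled
...   | U , U-tight , all∈U =
  y , Feasible∧Tight⇒InB' y-feas (subst (Tight p y) (⊆-antisym ⊆⊤ (λ {s} _ → all∈U s tt)) U-tight)
    , y≤x

crossing-by : ∀ {P : Pred ℤ 0ℓ} → Decidable P → ∀ k m → ¬ P m → P (m + + k) →
  ∃ λ β → P β × ¬ P (β - 1ℤ)
crossing-by {P} P? ℕ.zero m ¬Pm Pm+0 = contradiction (subst P (+-identityʳ m) Pm+0) ¬Pm
crossing-by {P} P? (ℕ.suc k) m ¬Pm Pm+k+1 with P? ((m + + ℕ.suc k) - 1ℤ)
... | no  ¬Pm+k = m + + ℕ.suc k , Pm+k+1 , ¬Pm+k
... | yes Pm+k  = crossing-by P? k m ¬Pm (subst P ([i+1+k]-1≡i+k m k) Pm+k)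

crossing : ∀ {P : Pred ℤ 0ℓ} → Decidable P → ∀ {m m'} → m ≤ m' → ¬ P m → P m' →
  ∃ λ β → P β × ¬ P (β - 1ℤ)
crossing {P} P? m≤m' ¬Pm Pm' = crossing-by P? _ _ ¬Pm (subst P (≤⇒≡+∣-∣ m≤m') Pm')

constant-feasible : ∀ {p : SetFn n} {N} → p ⊥ ≡ fin 0ℤ → (∀ X → p X ≤∞ (+ N)) →
  Feasible p (λ _ → + N)
constant-feasible {n} {p} {N} p⊥ p≤N Z with nonempty? Z
... | yes (s , s∈Z) = ≤∞-trans {p Z} (p≤N Z) (begin
  + N              ≤⟨ +≤+ (ℕ.m≤m*n N ∣ Z ∣ {{ℕ.>-nonZero 0<∣Z∣}}) ⟩
  + (N ℕ.* ∣ Z ∣)  ≡⟨ pos-* N ∣ Z ∣ ⟩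
  + N * + ∣ Z ∣    ≡⟨ sym (x̃-const (+ N) Z) ⟩
  x̃ (λ _ → + N) Z ∎)
  where
  open ≤-Reasoning
  0<∣Z∣ : 0 < ∣ Z ∣
  0<∣Z∣ = ℕ.≤-<-trans ℕ.z≤n (x∈p⇒∣p-x∣<∣p∣ s∈Z)
... | no  Z-empty  = subst (λ Y → p Y ≤∞ x̃ (λ _ → + N) Y) (sym (Empty-unique Z-empty))
  (subst (_≤∞ x̃ (λ _ → + N) (⊥ {n})) (sym p⊥) (≤-reflexive (sym (x̃-⊥ {n} (λ _ → + N)))))

constant-infeasible : ∀ {p : SetFn (ℕ.suc n)} {c} → p ⊤ ≡ fin c → ¬ Feasible p (λ _ → -[1+ ∣ c ∣ℤ ])
constant-infeasible {n} {p} {c} p⊤ feas = <-irrefl refl (≤-<-trans c≤L (L<c c))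
  where
  L = -[1+ ∣ c ∣ℤ ]
  S = ⊤ {ℕ.suc n}
  c≤L : c ≤ L
  c≤L = begin
    c                 ≤⟨ subst (_≤∞ x̃ (λ _ → L) S) p⊤ (feas S) ⟩
    x̃ (λ _ → L) S    ≡⟨ x̃-const L S ⟩
    L * + ∣ S ∣       ≡⟨ cong (λ k → L * + k) (∣⊤∣≡n (ℕ.suc n)) ⟩
    L * + ℕ.suc n     ≡⟨ *-suc L (+ n) ⟩
    L + L * + n       ≤⟨ +-monoʳ-≤ L (*-monoʳ-≤-nonNeg (+ n) (-≤+ {m = ∣ c ∣ℤ} {n = 0})) ⟩
    L + 0ℤ            ≡⟨ +-identityʳ L ⟩
    L                 ∎
    where open ≤-Reasoning
  L<c : ∀ c → -[1+ ∣ c ∣ℤ ] Data.Integer.< c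
  L<c (+ _)      = -<+
  L<c -[1+ m ] = -<- (ℕ.n<1+n m)

least-feasible-constant : ∀ {p : SetFn (ℕ.suc n)} {c} → p ⊥ ≡ fin 0ℤ → p ⊤ ≡ fin c →
  ∃ λ β → Feasible p (λ _ → β) × ¬ Feasible p (λ _ → β - 1ℤ)
least-feasible-constant {p = p} p⊥ p⊤ with bounded p
... | N , p≤N =
  crossing (λ β → feasible? p (λ _ → β)) -≤+ (constant-infeasible p⊤) (constant-feasible p⊥ p≤N)

h≤numEq : ∀ {p : SetFn n} {β z} → Feasible p z → Covered β z → ∀ X → h p β X ≤∞ (+ numEq z β)
h≤numEq {p = p} {β} {z} z-feas z≤β X = ⊖∞-≤∞ (p X) _ _ (≤∞-trans {p X} (z-feas X) (begin
  x̃ z X                    ≤⟨ x̃-mono (λ s → ≤-twoLevelCap {z = z} s (z≤β s)) X ⟩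
  x̃ (twoLevelCap β z) X    ≡⟨ x̃-twoLevelCap β z X ⟩
  W + + numEqIn X z β      ≤⟨ +-monoʳ-≤ W (+≤+ (numEqIn≤numEq X z β)) ⟩
  W + + numEq z β          ∎))
  where
  open ≤-Reasoning
  W = (β - 1ℤ) * + ∣ X ∣

h≡numEq : ∀ {p : SetFn n} {β x U} → TwoLevel β x → Tight p x U → (∀ s → x s ≡ β → s ∈ U) →
  h p β U ≡ fin (+ numEq x β)
h≡numEq {p = p} {β} {x} {U} x-two U-tight β∈U = begin
  p U ⊖∞ W                         ≡⟨ cong (_⊖∞ W) U-tight ⟩
  fin (x̃ x U - W)                  ≡⟨ cong (λ v → fin (v - W)) x̃xU ⟩
  fin ((W + + numEqIn U x β) - W)  ≡⟨ cong fin (lemma W _) ⟩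
  fin (+ numEqIn U x β)            ≡⟨ cong (fin ∘ +_) numEqIn≡numEq ⟩
  fin (+ numEq x β)                ∎
  where
  open ≡-Reasoning
  W = (β - 1ℤ) * + ∣ U ∣
  x̃xU : x̃ x U ≡ W + + numEqIn U x β
  x̃xU = trans (x̃-cong (λ s → ≡-twoLevelCap {z = x} s (x-two s)) U) (x̃-twoLevelCap β x U)
  numEqIn≡numEq : numEqIn U x β ≡ numEq x β
  numEqIn≡numEq = ℕ.≤-antisym (numEqIn≤numEq U x β) (numEq≤numEqIn U x β β∈U)
  lemma : ∀ w r → (w + r) - w ≡ r
  lemma = solve-∀

h≡⇒≤numEq : ∀ {p : SetFn n} {β z U r} → h p β U ≡ fin (+ r) → Feasible p z → Covered β z →
  r ℕ.≤ numEq z β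
h≡⇒≤numEq {p = p} {U = U} hU≡r z-feas z≤β =
  drop‿+≤+ (subst (_≤∞ _) hU≡r (h≤numEq {p = p} z-feas z≤β U))

isBeta1 : ∀ {p : SetFn n} {β z} → ¬ Feasible p (λ _ → β - 1ℤ) → InB' p z → Covered β z → IsBeta1 p β
isBeta1 {n} {p} {β} {z} infeasible z∈B z≤β = (z , z∈B , z≤β , attained) , minimal
  where
  attained : ∃ λ s → z s ≡ β
  attained with any? (λ s → z s ≟ β)
  ... | yes found = found
  ... | no  none  = contradiction (feasible-mono (InB'⇒Feasible z∈B) z≤β-1) infeasible
    where
    z≤β-1 : ∀ s → z s ≤ β - 1ℤ
    z≤β-1 s = ≤∧≢⇒≤-1 (z≤β s) (λ zs≡β → none (s , zs≡β))
  minimal : ∀ z' m → InB' p z' → IsMaxComp z' m → β ≤ m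
  minimal z' m z'∈B (z'≤m , _) with β ≤? m
  ... | yes β≤m = β≤m
  ... | no  β≰m =
    contradiction (feasible-mono (InB'⇒Feasible z'∈B) (λ s → ≤-trans (z'≤m s) (≰⇒≤-1 β≰m))) infeasible

isR1 : ∀ {p : SetFn n} {β z U} → InB' p z → Covered β z → h p β U ≡ fin (+ numEq z β) →
  IsR1 p β (numEq z β)
isR1 {p = p} z∈B z≤β hU =
  (_ , z∈B , z≤β , refl) , λ z' z'∈B z'≤β → h≡⇒≤numEq {p = p} hU (InB'⇒Feasible z'∈B) z'≤β

isMaxSet : ∀ {p : SetFn n} {β z U} → Feasible p z → Covered β z → h p β U ≡ fin (+ numEq z β) →
  IsMaxSet (h p β) (+ numEq z β)
isMaxSet {p = p} z-feas z≤β hU = h≤numEq {p = p} z-feas z≤β , _ , hU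

duality : ∀ {p : SetFn n} {β x y U} → ¬ Feasible p (λ _ → β - 1ℤ) →
  TwoLevel β x → Tight p x U → (∀ s → x s ≡ β → s ∈ U) → InB' p y → (∀ s → y s ≤ x s) →
  IsBeta1 p β × (Σ ℕ λ r₁ → IsR1 p β r₁ × IsMaxSet (h p β) (+ r₁))
duality {p = p} {β} {x} {y} {U} β-1-infeas x-two U-tight β∈U y∈B y≤x =
  isBeta1 β-1-infeas y∈B y≤β , numEq y β , isR1 y∈B y≤β hU , isMaxSet (InB'⇒Feasible y∈B) y≤β hU
  where
  x≤β : Covered β x
  x≤β s = [ ≤-reflexive , (λ xs≡β-1 → subst (_≤ β) (sym xs≡β-1) (i-j≤i β 1ℤ)) ] (x-two s)
  y≤β : Covered β y
  y≤β s = ≤-trans (y≤x s) (x≤β s)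
  hx : h p β U ≡ fin (+ numEq x β)
  hx = h≡numEq {p = p} x-two U-tight β∈U
  hU : h p β U ≡ fin (+ numEq y β)
  hU = trans hx (cong (fin ∘ +_)
         (ℕ.≤-antisym (h≡⇒≤numEq {p = p} hx (InB'⇒Feasible y∈B) y≤β) (numEq-mono y≤x x≤β)))

theorem4p3 : (n : ℕ) → 0 < n → (p : SetFn n) →
    p ⊥ ≡ fin 0ℤ → (∃ λ c → p ⊤ ≡ fin c) → Supermodular p →
    Σ ℤ λ β₁ → IsBeta1 p β₁ ×
      (Σ ℕ λ r₁ → IsR1 p β₁ r₁ × IsMaxSet (h p β₁) (+ r₁))
theorem4p3 ℕ.zero    () _ _ _ _
theorem4p3 (ℕ.suc n) _  p p⊥ (c , p⊤) supermodular =
  let β , β-feas , β-1-infeas       = least-feasible-constant {p = p} p⊥ p⊤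
      x , x-feas , x-two , x-tightAt = lower-to-two-levels {p = p} p⊤ β-feas
      U , U-tight , β∈U             = tight-cover supermodular p⊥ {x = x} x-feas
                                        {P = λ s → x s ≡ β} (λ s → x s ≟ β) x-tightAt
      y , y∈B , y≤x                 = B'-below {x = x} supermodular p⊥ p⊤ x-feas
  in β , duality {p = p} β-1-infeas x-two U-tight β∈U y∈B y≤x
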